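{- For every $n\geq 0$, the number of $DD$-equivalence classes of the set $\mathcal{L}_n$ of Łukasiewicz paths of length $n$ is $g_n$, where $g_0=1$, $g_1=1$, $g_2=1$, $g_3=2$ and $g_n=g_{n-1}+g_{n-2}+g_{n-4}$ for $n\geq 4$.
   Context: A Łukasiewicz path of length $n$ is a sequence of $n$ steps from $\{(1,i): i\geq -1\}$ starting at $(0,0)$, ending at $(n,0)$ and never going below the $x$-axis. Write $D=(1,-1)$, $F=(1,0)$, $U_i=(1,i)$ for $i\geq1$. Steps are numbered $1,\dots,n$; an occurrence of the pattern $DD$ (two consecutive $D$ steps) is at position $i$ if its first step is the $i$-th step. Two paths of the same length are $DD$-equivalent if the sets of occurrence positions of $DD$ in them are identical. -}

module Defs where

open import Data.Nat using (ℕ; zero; suc; _+_)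
open import Data.List using (List; []; _∷_; length)
open import Data.List.Relation.Unary.Any using (Any)
open import Data.List.Relation.Unary.AllPairs using (AllPairs)
open import Data.Product using (Σ; _×_; proj₁)
open import Relation.Binary.PropositionalEquality using (_≡_)
open import Relation.Nullary using (¬_)
open import Function.Bundles using (_⇔_)

-- Steps: D = (1,-1), F = (1,0), U k = U_{k+1} = (1,k+1)
data Step : Set where
  D : Step
  F : Step
  U : ℕ → Step

-- LukFrom h w : the step word w, started at height h, never goes below
-- the x-axis and ends at height 0.
data LukFrom : ℕ → List Step → Set where
  nil : LukFrom 0 []
  d   : ∀ {h xs} → LukFrom h xs → LukFrom (suc h) (D ∷ xs)
  f   : ∀ {h xs} → LukFrom h xs → LukFrom h (F ∷ xs)
  u   : ∀ {h k xs} → LukFrom (h + suc k) xs → LukFrom h (U k ∷ xs)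

LukPath : ℕ → Set
LukPath n = Σ (List Step) λ w → length w ≡ n × LukFrom 0 w

-- DDAt w i : an occurrence of DD starts at the i-th step (steps numbered from 1)
data DDAt : List Step → ℕ → Set where
  here  : ∀ {xs} → DDAt (D ∷ D ∷ xs) 1
  there : ∀ {x xs i} → DDAt xs i → DDAt (x ∷ xs) (suc i)

_≈DD_ : ∀ {n} → LukPath n → LukPath n → Set
p ≈DD q = ∀ i → DDAt (proj₁ p) i ⇔ DDAt (proj₁ q) i

NumDDClasses : ℕ → ℕ → Set
NumDDClasses n k =
  Σ (List (LukPath n)) λ reps →
    length reps ≡ k
    × AllPairs (λ p q → ¬ (p ≈DD q)) reps
    × (∀ (p : LukPath n) → Any (λ r → p ≈DD r) reps)

g : ℕ → ℕ
g 0 = 1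
g 1 = 1
g 2 = 1
g 3 = 2
g (suc (suc (suc (suc n)))) = g (suc (suc (suc n))) + g (suc (suc n)) + g n

-- Two paths of the same length are DD-equivalent iff they have the same DD-word, the Boolean
-- word whose i-th letter says whether a DD starts at step i.  The DD-word of a Łukasiewicz
-- path never contains 101, since ones at i and i+2 make steps i..i+3 all D and hence put a
-- one at i+1, and it never starts with 1, since a path cannot start with D.  Conversely every
-- such word is realised: make step i a D exactly when letter i-1 or i is 1, and let every
-- other step rise by the length of the run of Ds that follows it.  Counting these words with
-- the three-state automaton for 101-free words yields the recurrence defining g.

module Submission where

open import Defs
open import Data.Bool using (Bool; true; false; _∧_; _∨_)
open import Data.Empty using (⊥-elim)
open import Data.List using (List; []; _∷_; length; map; _++_)
open import Data.List.Properties using (length-map; length-++; ∷-injectiveˡ; ∷-injectiveʳ)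
open import Data.List.Membership.Propositional using (_∈_)
open import Data.List.Membership.Propositional.Properties using (∈-map⁺; ∈-map⁻; ∈-++⁺ˡ; ∈-++⁺ʳ)
open import Data.List.Relation.Binary.Disjoint.Propositional using (Disjoint)
open import Data.List.Relation.Unary.All as All using (All; []; _∷_)
import Data.List.Relation.Unary.All.Properties as All
open import Data.List.Relation.Unary.Any as Any using (Any)
import Data.List.Relation.Unary.Any.Properties as Any
open import Data.List.Relation.Unary.AllPairs as AllPairs using (AllPairs; []; _∷_)
import Data.List.Relation.Unary.AllPairs.Properties as AllPairs
open import Data.List.Relation.Unary.Unique.Propositional using (Unique)
import Data.List.Relation.Unary.Unique.Propositional.Properties as Unique
open import Data.Nat using (ℕ; zero; suc; _+_; pred)
open import Data.Nat.Properties using (suc-injective; +-assoc; +-comm)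
open import Data.Product using (Σ; ∃; _×_; _,_; proj₁)
open import Function using (_∘_)
open import Function.Bundles using (_⇔_; mk⇔; Equivalence)
open import Function.Construct.Composition using (_⇔-∘_)
open import Function.Construct.Symmetry using (⇔-sym)
open import Relation.Binary.PropositionalEquality
open import Relation.Nullary using (¬_)

data Has101 : List Bool → Set where
  here  : ∀ {bs} → Has101 (true ∷ false ∷ true ∷ bs)
  there : ∀ {b bs} → Has101 bs → Has101 (b ∷ bs)

andAdjacent : List Bool → List Bool
andAdjacent []           = []
andAdjacent (a ∷ [])     = []
andAdjacent (a ∷ b ∷ bs) = (a ∧ b) ∷ andAdjacent (b ∷ bs)

length-andAdjacent : ∀ bs → length (andAdjacent bs) ≡ pred (length bs)
length-andAdjacent []           = refl
length-andAdjacent (a ∷ [])     = refl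
length-andAdjacent (a ∷ b ∷ bs) = cong suc (length-andAdjacent (b ∷ bs))

andAdjacent-¬Has101 : ∀ bs → ¬ Has101 (andAdjacent bs)
andAdjacent-¬Has101 (false ∷ b ∷ bs)                (there h) = andAdjacent-¬Has101 (b ∷ bs) h
andAdjacent-¬Has101 (true ∷ false ∷ bs)             (there h) = andAdjacent-¬Has101 (false ∷ bs) h
andAdjacent-¬Has101 (true ∷ true ∷ [])              (there ())
andAdjacent-¬Has101 (true ∷ true ∷ true ∷ bs)       (there h) = andAdjacent-¬Has101 (true ∷ true ∷ bs) h
andAdjacent-¬Has101 (true ∷ true ∷ false ∷ [])      (there h) = andAdjacent-¬Has101 (true ∷ false ∷ []) h
andAdjacent-¬Has101 (true ∷ true ∷ false ∷ c ∷ bs)  (there h) = andAdjacent-¬Has101 (true ∷ false ∷ c ∷ bs) h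

neighbourOr : Bool → List Bool → List Bool
neighbourOr a []       = a ∷ []
neighbourOr a (b ∷ bs) = (a ∨ b) ∷ neighbourOr b bs

length-neighbourOr : ∀ a bs → length (neighbourOr a bs) ≡ suc (length bs)
length-neighbourOr a []       = refl
length-neighbourOr a (b ∷ bs) = cong suc (length-neighbourOr b bs)

andAdjacent-neighbourOr : ∀ a bs → ¬ Has101 (a ∷ bs) → andAdjacent (neighbourOr a bs) ≡ bs
andAdjacent-neighbourOr a []           _     = refl
andAdjacent-neighbourOr a (b ∷ [])     _     = cong (_∷ []) (∨-∧-absorb a b)
  where
  ∨-∧-absorb : ∀ a b → (a ∨ b) ∧ b ≡ b
  ∨-∧-absorb true  true  = refl
  ∨-∧-absorb true  false = refl
  ∨-∧-absorb false true  = refl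
  ∨-∧-absorb false false = refl
andAdjacent-neighbourOr a (b ∷ c ∷ cs) no101 =
  cong₂ _∷_ (∨-∧-∨-middle a b c no101) (andAdjacent-neighbourOr b (c ∷ cs) (no101 ∘ there))
  where
  ∨-∧-∨-middle : ∀ a b c → ¬ Has101 (a ∷ b ∷ c ∷ cs) → (a ∨ b) ∧ (b ∨ c) ≡ b
  ∨-∧-∨-middle true  true  c     _     = refl
  ∨-∧-∨-middle true  false false _     = refl
  ∨-∧-∨-middle true  false true  no101 = ⊥-elim (no101 here)
  ∨-∧-∨-middle false true  c     _     = refl
  ∨-∧-∨-middle false false c     _     = refl

data TrueAt : List Bool → ℕ → Set where
  here  : ∀ {bs} → TrueAt (true ∷ bs) 1
  there : ∀ {b bs i} → TrueAt bs i → TrueAt (b ∷ bs) (suc i)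

≡-fromTrueAt : ∀ {bs cs} → length bs ≡ length cs → (∀ i → TrueAt bs i ⇔ TrueAt cs i) → bs ≡ cs
≡-fromTrueAt {[]}     {[]}     _  _ = refl
≡-fromTrueAt {b ∷ bs} {c ∷ cs} eq e =
  cong₂ _∷_ (≡-head (e 1)) (≡-fromTrueAt (suc-injective eq) (⇔-tail ∘ e ∘ suc))
  where
  ≡-head : ∀ {b c} → TrueAt (b ∷ bs) 1 ⇔ TrueAt (c ∷ cs) 1 → b ≡ c
  ≡-head {true}  {true}  _ = refl
  ≡-head {false} {false} _ = refl
  ≡-head {true}  {false} e with Equivalence.to e here
  ... | there ()
  ≡-head {false} {true}  e with Equivalence.from e here
  ... | there ()
  TrueAt-tail : ∀ {a as i} → TrueAt (a ∷ as) (suc (suc i)) ⇔ TrueAt as (suc i)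
  TrueAt-tail = mk⇔ (λ { (there t) → t }) there
  ⇔-tail : ∀ {i} → TrueAt (b ∷ bs) (suc i) ⇔ TrueAt (c ∷ cs) (suc i) → TrueAt bs i ⇔ TrueAt cs i
  ⇔-tail {zero}  _ = mk⇔ (λ ()) (λ ())
  ⇔-tail {suc i} e = TrueAt-tail ⇔-∘ (e ⇔-∘ ⇔-sym TrueAt-tail)

isD : Step → Bool
isD D     = true
isD F     = false
isD (U _) = false

ddWord : List Step → List Bool
ddWord = andAdjacent ∘ map isD

length-ddWord : ∀ w → length (ddWord w) ≡ pred (length w)
length-ddWord w = trans (length-andAdjacent (map isD w)) (cong pred (length-map isD w))

DDAt⇔TrueAt : ∀ w {i} → DDAt w i ⇔ TrueAt (ddWord w) i
DDAt⇔TrueAt w = mk⇔ (toTrueAt w) (fromTrueAt w)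
  where
  toTrueAt : ∀ w {i} → DDAt w i → TrueAt (ddWord w) i
  toTrueAt (D ∷ D ∷ w)     here      = here
  toTrueAt (x ∷ y ∷ w)     (there o) = there (toTrueAt (y ∷ w) o)
  fromTrueAt : ∀ w {i} → TrueAt (ddWord w) i → DDAt w i
  fromTrueAt (D ∷ D ∷ w)   here      = here
  fromTrueAt (x ∷ y ∷ w)   (there t) = there (fromTrueAt (y ∷ w) t)

≈DD⇔≡ddWord : ∀ {n} (p q : LukPath n) → p ≈DD q ⇔ ddWord (proj₁ p) ≡ ddWord (proj₁ q)
≈DD⇔≡ddWord (w , |w| , _) (v , |v| , _) = mk⇔ to from
  where
  to : (∀ i → DDAt w i ⇔ DDAt v i) → ddWord w ≡ ddWord v
  to e = ≡-fromTrueAt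
    (trans (length-ddWord w) (trans (cong pred (trans |w| (sym |v|))) (sym (length-ddWord v))))
    (λ i → DDAt⇔TrueAt v ⇔-∘ (e i ⇔-∘ ⇔-sym (DDAt⇔TrueAt w)))
  from : ddWord w ≡ ddWord v → ∀ i → DDAt w i ⇔ DDAt v i
  from eq i = ⇔-sym (DDAt⇔TrueAt v) ⇔-∘ subst (λ c → DDAt w i ⇔ TrueAt c i) eq (DDAt⇔TrueAt w)

riseBy : ℕ → Step
riseBy zero    = F
riseBy (suc k) = U k

leadingTrues : List Bool → ℕ
leadingTrues []           = 0
leadingTrues (true ∷ bs)  = suc (leadingTrues bs)
leadingTrues (false ∷ bs) = 0

fillSteps : List Bool → List Step
fillSteps []           = []
fillSteps (true ∷ bs)  = D ∷ fillSteps bs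
fillSteps (false ∷ bs) = riseBy (leadingTrues bs) ∷ fillSteps bs

map-isD-fillSteps : ∀ bs → map isD (fillSteps bs) ≡ bs
map-isD-fillSteps []           = refl
map-isD-fillSteps (true ∷ bs)  = cong (true ∷_) (map-isD-fillSteps bs)
map-isD-fillSteps (false ∷ bs) = cong₂ _∷_ (isD-riseBy (leadingTrues bs)) (map-isD-fillSteps bs)
  where
  isD-riseBy : ∀ k → isD (riseBy k) ≡ false
  isD-riseBy zero    = refl
  isD-riseBy (suc k) = refl

length-fillSteps : ∀ bs → length (fillSteps bs) ≡ length bs
length-fillSteps []           = refl
length-fillSteps (true ∷ bs)  = cong suc (length-fillSteps bs)
length-fillSteps (false ∷ bs) = cong suc (length-fillSteps bs)

fillSteps-LukFrom : ∀ bs → LukFrom (leadingTrues bs) (fillSteps bs)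
fillSteps-LukFrom []           = nil
fillSteps-LukFrom (true ∷ bs)  = d (fillSteps-LukFrom bs)
fillSteps-LukFrom (false ∷ bs) = riseBy-LukFrom (leadingTrues bs) (fillSteps-LukFrom bs)
  where
  riseBy-LukFrom : ∀ k {w} → LukFrom k w → LukFrom 0 (riseBy k ∷ w)
  riseBy-LukFrom zero    = f
  riseBy-LukFrom (suc k) = u

realisation : List Bool → List Step
realisation = fillSteps ∘ neighbourOr false

ddWord-realisation : ∀ bs → ¬ Has101 bs → ddWord (realisation bs) ≡ bs
ddWord-realisation bs no101 = begin
  andAdjacent (map isD (fillSteps (neighbourOr false bs)))
    ≡⟨ cong andAdjacent (map-isD-fillSteps (neighbourOr false bs)) ⟩
  andAdjacent (neighbourOr false bs)
    ≡⟨ andAdjacent-neighbourOr false bs (λ { (there h) → no101 h }) ⟩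
  bs ∎
  where open ≡-Reasoning

length-realisation : ∀ bs → length (realisation bs) ≡ suc (length bs)
length-realisation bs = trans (length-fillSteps (neighbourOr false bs)) (length-neighbourOr false bs)

realisation-LukFrom : ∀ bs → ¬ Has101 (true ∷ false ∷ bs) → LukFrom 0 (realisation bs)
realisation-LukFrom []           _     = fillSteps-LukFrom (false ∷ [])
realisation-LukFrom (false ∷ bs) _     = fillSteps-LukFrom (neighbourOr false (false ∷ bs))
realisation-LukFrom (true ∷ bs)  no101 = ⊥-elim (no101 here)

-- The longest suffix of the letters read so far that is a proper prefix of 101.
data State : Set where
  s₀ s₁ s₁₀ : State

context : State → List Bool
context s₀  = []
context s₁  = true ∷ []
context s₁₀ = true ∷ false ∷ []

avoiding : State → ℕ → List (List Bool)
avoiding s   zero    = [] ∷ []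
avoiding s₀  (suc m) = map (false ∷_) (avoiding s₀ m) ++ map (true ∷_) (avoiding s₁ m)
avoiding s₁  (suc m) = map (true ∷_) (avoiding s₁ m) ++ map (false ∷_) (avoiding s₁₀ m)
avoiding s₁₀ (suc m) = map (false ∷_) (avoiding s₀ m)

avoiding-length : ∀ s m → All (λ w → length w ≡ m) (avoiding s m)
avoiding-length s   zero    = refl ∷ []
avoiding-length s₀  (suc m) =
  All.++⁺ (All.map⁺ (All.map (cong suc) (avoiding-length s₀ m)))
          (All.map⁺ (All.map (cong suc) (avoiding-length s₁ m)))
avoiding-length s₁  (suc m) =
  All.++⁺ (All.map⁺ (All.map (cong suc) (avoiding-length s₁ m)))
          (All.map⁺ (All.map (cong suc) (avoiding-length s₁₀ m)))
avoiding-length s₁₀ (suc m) = All.map⁺ (All.map (cong suc) (avoiding-length s₀ m))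

avoiding-sound : ∀ s m → All (λ w → ¬ Has101 (context s ++ w)) (avoiding s m)
avoiding-sound s₀  zero    = (λ ()) ∷ []
avoiding-sound s₁  zero    = (λ { (there ()) }) ∷ []
avoiding-sound s₁₀ zero    = (λ { (there (there ())) }) ∷ []
avoiding-sound s₀  (suc m) =
  All.++⁺ (All.map⁺ (All.map (λ no101 → λ { (there h) → no101 h }) (avoiding-sound s₀ m)))
          (All.map⁺ (avoiding-sound s₁ m))
avoiding-sound s₁  (suc m) =
  All.++⁺ (All.map⁺ (All.map (λ no101 → λ { (there h) → no101 h }) (avoiding-sound s₁ m)))
          (All.map⁺ (avoiding-sound s₁₀ m))
avoiding-sound s₁₀ (suc m) =
  All.map⁺ (All.map (λ no101 → λ { (there (there (there h))) → no101 h }) (avoiding-sound s₀ m))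

avoiding-complete : ∀ s w → ¬ Has101 (context s ++ w) → w ∈ avoiding s (length w)
avoiding-complete s   []          _     = Any.here refl
avoiding-complete s₀  (false ∷ w) no101 =
  ∈-++⁺ˡ (∈-map⁺ (false ∷_) (avoiding-complete s₀ w (no101 ∘ there)))
avoiding-complete s₀  (true ∷ w)  no101 =
  ∈-++⁺ʳ _ (∈-map⁺ (true ∷_) (avoiding-complete s₁ w no101))
avoiding-complete s₁  (true ∷ w)  no101 =
  ∈-++⁺ˡ (∈-map⁺ (true ∷_) (avoiding-complete s₁ w (no101 ∘ there)))
avoiding-complete s₁  (false ∷ w) no101 =
  ∈-++⁺ʳ _ (∈-map⁺ (false ∷_) (avoiding-complete s₁₀ w no101))
avoiding-complete s₁₀ (false ∷ w) no101 =
  ∈-map⁺ (false ∷_) (avoiding-complete s₀ w (λ h → no101 (there (there (there h)))))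
avoiding-complete s₁₀ (true ∷ w)  no101 = ⊥-elim (no101 here)

unique-map-∷ : ∀ {A : Set} {a : A} {xss} → Unique xss → Unique (map (a ∷_) xss)
unique-map-∷ = Unique.map⁺ ∷-injectiveʳ

disjoint-map-∷ : ∀ {A : Set} {a b : A} {xss yss} → a ≢ b → Disjoint (map (a ∷_) xss) (map (b ∷_) yss)
disjoint-map-∷ a≢b (v∈ , v∈′) with ∈-map⁻ (_ ∷_) v∈ | ∈-map⁻ (_ ∷_) v∈′
... | _ , _ , refl | _ , _ , eq = a≢b (∷-injectiveˡ eq)

avoiding-unique : ∀ s m → Unique (avoiding s m)
avoiding-unique s   zero    = [] ∷ []
avoiding-unique s₀  (suc m) =
  Unique.++⁺ (unique-map-∷ (avoiding-unique s₀ m)) (unique-map-∷ (avoiding-unique s₁ m))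
             (disjoint-map-∷ (λ ()))
avoiding-unique s₁  (suc m) =
  Unique.++⁺ (unique-map-∷ (avoiding-unique s₁ m)) (unique-map-∷ (avoiding-unique s₁₀ m))
             (disjoint-map-∷ (λ ()))
avoiding-unique s₁₀ (suc m) = unique-map-∷ (avoiding-unique s₀ m)

count : State → ℕ → ℕ
count s m = length (avoiding s m)

length-map-∷-++ : ∀ {A : Set} (a b : A) (xss yss : List (List A)) →
                  length (map (a ∷_) xss ++ map (b ∷_) yss) ≡ length xss + length yss
length-map-∷-++ a b xss yss =
  trans (length-++ (map (a ∷_) xss)) (cong₂ _+_ (length-map (a ∷_) xss) (length-map (b ∷_) yss))

count-s₀ : ∀ m → count s₀ (suc m) ≡ count s₀ m + count s₁ m
count-s₀ m = length-map-∷-++ false true (avoiding s₀ m) (avoiding s₁ m)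

count-s₁ : ∀ m → count s₁ (suc m) ≡ count s₁ m + count s₁₀ m
count-s₁ m = length-map-∷-++ true false (avoiding s₁ m) (avoiding s₁₀ m)

count-s₁₀ : ∀ m → count s₁₀ (suc m) ≡ count s₀ m
count-s₁₀ m = length-map (false ∷_) (avoiding s₀ m)

count-s₁₀-recurrence : ∀ m → count s₁₀ (4 + m) ≡ count s₁₀ (3 + m) + count s₁₀ (2 + m) + count s₁₀ m
count-s₁₀-recurrence m = begin
  c (4 + m)                                ≡⟨ count-s₁₀ (3 + m) ⟩
  a (3 + m)                                ≡⟨ count-s₀ (2 + m) ⟩
  a (2 + m) + b (2 + m)                    ≡⟨ cong₂ _+_ (sym (count-s₁₀ (2 + m))) (count-s₁ (1 + m)) ⟩
  c (3 + m) + (b (1 + m) + c (1 + m))      ≡⟨ cong (λ x → c (3 + m) + (x + c (1 + m))) (count-s₁ m) ⟩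
  c (3 + m) + ((b m + c m) + c (1 + m))    ≡⟨ cong (c (3 + m) +_) (rotate (b m) (c m) (c (1 + m))) ⟩
  c (3 + m) + ((c (1 + m) + b m) + c m)    ≡⟨ cong (λ x → c (3 + m) + (x + c m)) (sym c₂) ⟩
  c (3 + m) + (c (2 + m) + c m)            ≡⟨ sym (+-assoc (c (3 + m)) (c (2 + m)) (c m)) ⟩
  c (3 + m) + c (2 + m) + c m              ∎
  where
  open ≡-Reasoning
  a b c : ℕ → ℕ
  a = count s₀
  b = count s₁
  c = count s₁₀
  rotate : ∀ x y z → (x + y) + z ≡ (z + x) + y
  rotate x y z = trans (+-comm (x + y) z) (sym (+-assoc z x y))
  c₂ : c (2 + m) ≡ c (1 + m) + b m
  c₂ = trans (count-s₁₀ (1 + m)) (trans (count-s₀ m) (cong (_+ b m) (sym (count-s₁₀ m))))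

count-s₁₀≡g : ∀ m → count s₁₀ m ≡ g (suc m)
count-s₁₀≡g 0 = refl
count-s₁₀≡g 1 = refl
count-s₁₀≡g 2 = refl
count-s₁₀≡g 3 = refl
count-s₁₀≡g (suc (suc (suc (suc m)))) =
  trans (count-s₁₀-recurrence m)
        (cong₂ _+_ (cong₂ _+_ (count-s₁₀≡g (suc (suc (suc m)))) (count-s₁₀≡g (suc (suc m))))
                   (count-s₁₀≡g m))

representatives-of-kernel :
  ∀ {A K : Set} {_≈_ : A → A → Set} (key : A → K) → (∀ a b → a ≈ b ⇔ key a ≡ key b) →
  ∀ {ks} → Unique ks → All (λ k → ∃ λ a → key a ≡ k) ks → (∀ a → key a ∈ ks) →
  Σ (List A) λ reps → length reps ≡ length ks × AllPairs (λ a b → ¬ a ≈ b) reps × (∀ a → Any (a ≈_) reps)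
representatives-of-kernel {A} {K} {_≈_} key ≈⇔≡ {ks} unique fibres cover =
  reps , length-reps , distinct , covering
  where
  map-key-reduce : ∀ {ks} (fs : All (λ k → ∃ λ a → key a ≡ k) ks) → map key (All.reduce proj₁ fs) ≡ ks
  map-key-reduce []               = refl
  map-key-reduce ((a , refl) ∷ fs) = cong (key a ∷_) (map-key-reduce fs)
  reps : List A
  reps = All.reduce proj₁ fibres
  length-reps : length reps ≡ length ks
  length-reps = trans (sym (length-map key reps)) (cong length (map-key-reduce fibres))
  distinct : AllPairs (λ a b → ¬ a ≈ b) reps
  distinct = AllPairs.map (λ k≢k′ a≈b → k≢k′ (Equivalence.to (≈⇔≡ _ _) a≈b))
                          (AllPairs.map⁻ (subst Unique (sym (map-key-reduce fibres)) unique))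
  covering : ∀ a → Any (a ≈_) reps
  covering a = Any.map (Equivalence.from (≈⇔≡ _ _))
                       (Any.map⁻ (subst (key a ∈_) (sym (map-key-reduce fibres)) (cover a)))

-- A Łukasiewicz path never starts with D, so its DD-word behaves as if preceded by 10.
ddWords : ℕ → List (List Bool)
ddWords zero    = [] ∷ []
ddWords (suc m) = avoiding s₁₀ m

ddWord-DD∷ : ∀ {x w} → LukFrom 0 (x ∷ w) → ddWord (D ∷ D ∷ x ∷ w) ≡ true ∷ false ∷ ddWord (x ∷ w)
ddWord-DD∷ (f _) = refl
ddWord-DD∷ (u _) = refl

ddWord-∈-ddWords : ∀ {n} (p : LukPath n) → ddWord (proj₁ p) ∈ ddWords n
ddWord-∈-ddWords ([]    , refl , nil) = Any.here refl
ddWord-∈-ddWords (x ∷ w , refl , luk) =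
  subst (λ m → ddWord (x ∷ w) ∈ avoiding s₁₀ m) (length-ddWord (x ∷ w))
        (avoiding-complete s₁₀ (ddWord (x ∷ w))
          (subst (¬_ ∘ Has101) (ddWord-DD∷ luk) (andAdjacent-¬Has101 (map isD (D ∷ D ∷ x ∷ w)))))

ddWords-realised : ∀ n → All (λ k → ∃ λ (p : LukPath n) → ddWord (proj₁ p) ≡ k) (ddWords n)
ddWords-realised zero    = (([] , refl , nil) , refl) ∷ []
ddWords-realised (suc m) = All.map realise (All.zip (avoiding-length s₁₀ m , avoiding-sound s₁₀ m))
  where
  realise : ∀ {bs} → length bs ≡ m × ¬ Has101 (true ∷ false ∷ bs) →
            ∃ λ (p : LukPath (suc m)) → ddWord (proj₁ p) ≡ bs
  realise {bs} (|bs| , no101) =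
    (realisation bs , trans (length-realisation bs) (cong suc |bs|) , realisation-LukFrom bs no101) ,
    ddWord-realisation bs (λ h → no101 (there (there h)))

ddWords-unique : ∀ n → Unique (ddWords n)
ddWords-unique zero    = [] ∷ []
ddWords-unique (suc m) = avoiding-unique s₁₀ m

length-ddWords : ∀ n → length (ddWords n) ≡ g n
length-ddWords zero    = refl
length-ddWords (suc m) = count-s₁₀≡g m

theorem5 : ∀ (n : ℕ) → NumDDClasses n (g n)
theorem5 n
  with representatives-of-kernel (ddWord ∘ proj₁) ≈DD⇔≡ddWord
         (ddWords-unique n) (ddWords-realised n) ddWord-∈-ddWords
... | reps , |reps| , distinct , covering = reps , trans |reps| (length-ddWords n) , distinct , covering
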